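{- Assume Conjecture B (stated in the context). Then for every prime number $b\ge 5$ and every integer $t\ge 0$ with $t\le b/4$, and for every positive integer $n$, the sequence of iterates $(S_{t,b}^k(n))_{k\ge1}$ stabilizes, i.e. eventually reaches a cycle or a fixed point of $S_{t,b}$.
   Context: For integers $t\ge 0$, $b\ge 2$, the $t$-shifted Sloane map in base $b$ is $S_{t,b}(n)=\prod_{i=0}^k (d_i+t)$, where $n=\sum_{i=0}^k d_ib^i$ is the base-$b$ expansion of $n$ ($0\le d_i\le b-1$, $d_k>0$); $S_{t,b}^k$ is its $k$-th iterate. For a base $q$, a digit $d$ and a positive integer $n$, $\#d(n)_q$ is the number of occurrences of $d$ in the base-$q$ expansion of $n$ and $\#(n)_q$ the number of base-$q$ digits of $n$. Given $\varepsilon>0$, $n$ is $\varepsilon$-equidistributed in base $q$ if $\left|\frac{\#d(n)_q}{\#(n)_q}-\frac1q\right|<\varepsilon$ for every $d\in\{0,\dots,q-1\}$. Conjecture B: For every integer $q>1$, every finite set $F=\{p_1,\dots,p_k\}$ of primes that does not contain all primes dividing $q$, and every positive integer $a$, for every $\varepsilon>0$ there exists $N$ such that $a\prod_{i=1}^k p_i^{\alpha_i}$ (nonnegative integers $\alpha_i$) is $\varepsilon$-equidistributed in base $q$ whenever $\alpha_i\ge N$ for some $i$. -}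

module Defs where

open import Data.Nat using (ℕ; zero; suc; _+_; _*_; _∸_; _^_; _≤_; _<_; _≟_)
open import Data.Nat.DivMod using (_/_; _%_)
open import Data.Nat.Divisibility using (_∣_)
open import Data.Nat.Primality using (Prime)
open import Data.Integer using (+_)
open import Data.Rational as ℚ using (ℚ; 0ℚ)
open import Data.List using (List; []; _∷_; length; foldr)
open import Data.Fin using (Fin)
open import Data.Product using (Σ; ∃; ∃-syntax; _×_)
open import Function.Definitions using (Injective)
open import Relation.Binary.PropositionalEquality using (_≡_; _≢_)
open import Relation.Nullary using (yes; no)

-- base-b digits of n, least significant first; fuel guarantees termination.
-- For n > 0 this is the usual expansion (d_0, ..., d_k) with d_k > 0.
digitsAux : ℕ → ℕ → ℕ → List ℕ
digitsAux zero    _       _       = []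
digitsAux (suc f) zero    _       = []
digitsAux (suc f) (suc c) zero    = []
digitsAux (suc f) (suc c) (suc m) =
  ((suc m) % (suc c)) ∷ digitsAux f (suc c) ((suc m) / (suc c))

digits : ℕ → ℕ → List ℕ
digits b zero    = 0 ∷ []
digits b (suc m) = digitsAux (suc m) b (suc m)

S : ℕ → ℕ → ℕ → ℕ
S t b n = foldr (λ d r → (d + t) * r) 1 (digits b n)

iter : (ℕ → ℕ) → ℕ → ℕ → ℕ
iter f zero    n = n
iter f (suc k) n = f (iter f k n)

count : ℕ → List ℕ → ℕ
count d [] = 0
count d (x ∷ xs) with x ≟ d
... | yes _ = suc (count d xs)
... | no  _ = count d xs

-- the rational c / m (m > 0 in all uses; value 0 for m = 0)
ratio : ℕ → ℕ → ℚ
ratio c zero    = 0ℚ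
ratio c (suc m) = (+ c) ℚ./ (suc m)

Equidistributed : ℚ → ℕ → ℕ → Set
Equidistributed ε q n =
  ∀ d → d < q →
    ℚ.∣ ratio (count d (digits q n)) (length (digits q n)) ℚ.- ratio 1 q ∣ ℚ.< ε

prodFin : (k : ℕ) → (Fin k → ℕ) → ℕ
prodFin zero    f = 1
prodFin (suc k) f = f Fin.zero * prodFin k (λ i → f (Fin.suc i))

ConjectureB : Set
ConjectureB =
  ∀ (q : ℕ) → 1 < q →
  ∀ (k : ℕ) (p : Fin k → ℕ) → (∀ i → Prime (p i)) → Injective _≡_ _≡_ p →
  (∃[ r ] (Prime r × r ∣ q × (∀ i → p i ≢ r))) →
  ∀ (a : ℕ) → 0 < a →
  ∀ (ε : ℚ) → 0ℚ ℚ.< ε →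
  ∃[ N ] (∀ (α : Fin k → ℕ) → (∃[ i ] (N ≤ α i)) →
            Equidistributed ε q (a * prodFin k (λ i → p i ^ α i)))

-- For t = 0 the digit product of n is at most n, so orbits are bounded. For t ≥ 1 every factor
-- d + t of S lies in [1, 2b), so S takes values in the monoid generated by b and the primes below
-- 2b other than b, i.e. in numbers b^j m with m a product of those primes; and S(b^j m) = t^j S(m),
-- as trailing zeros contribute factors t. Conjecture B, applied to these primes with a = 1 and
-- ε = 1/(bR), makes every large m equidistributed in base b: each digit occurs fewer than
-- (R+1)L/(bR) times among the L digits of m, hence S(m)^(bR) ≤ (∏_{d<b} (d+t))^((R+1)L).
-- Pairing d with b-1-d and AM-GM give ∏_{d<b} (d+t) < b^b whenever 2t ≤ b, and R is chosen
-- (via Bernoulli's inequality) so that this forces S(m) < m. For small m and large j instead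
-- t^j S(m) < (2t)^j ≤ b^j. So S decreases on all its large values, every orbit is bounded, and
-- a bounded orbit is eventually periodic by pigeonhole.
module Submission where

open import Defs
open import Data.Nat
open import Data.Nat.Properties
open import Algebra.Properties.CommutativeSemigroup *-commutativeSemigroup using (x∙yz≈y∙xz)
open import Data.Nat.DivMod
open import Data.Nat.Divisibility using (_∣_; ∣⇒≤; m∣m*n; n∣m*n; ∣-trans; ∣-refl)
open import Data.Nat.ListAction using (product)
open import Data.Nat.Primality using (Prime; prime?; prime⇒nonZero)
open import Data.Nat.Primality.Factorisation using (factorise; PrimeFactorisation)
open import Data.Nat.Tactic.RingSolver using (solve-∀)
open import Data.Fin using (Fin; zero; suc; toℕ; fromℕ<)
import Data.Fin.Properties as Fin
import Data.Integer as ℤ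
import Data.Integer.Properties as ℤ
open import Data.List using (List; []; _∷_; length; foldr; lookup; filter; upTo)
open import Data.List.Membership.Propositional using (_∈_)
open import Data.List.Membership.Propositional.Properties using (∈-lookup; ∈-filter⁺; ∈-filter⁻; ∈-upTo⁺)
open import Data.List.Relation.Unary.All as All using (All; []; _∷_)
open import Data.List.Relation.Unary.AllPairs using ([]; _∷_)
open import Data.List.Relation.Unary.Any using (index)
open import Data.List.Relation.Unary.Any.Properties using (lookup-index)
open import Data.List.Relation.Unary.Unique.Propositional using (Unique)
open import Data.List.Relation.Unary.Unique.Propositional.Properties using (upTo⁺; filter⁺)
open import Data.Product using (Σ; ∃-syntax; _×_; _,_; proj₁; proj₂)
import Data.Rational as ℚ
import Data.Rational.Properties as ℚ
import Data.Rational.Unnormalised as ℚᵘ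
import Data.Rational.Unnormalised.Properties as ℚᵘ
open import Data.Sum using (inj₁; inj₂; [_,_]′)
open import Function using (_∘_)
open import Function.Definitions using (Injective)
open import Relation.Binary.PropositionalEquality
open import Relation.Nullary using (yes; no; contradiction; ¬?; _×-dec_)
open import Relation.Unary using (Decidable)

^-distribʳ-* : ∀ m n o → (m * n) ^ o ≡ m ^ o * n ^ o
^-distribʳ-* m n zero    = refl
^-distribʳ-* m n (suc o) rewrite ^-distribʳ-* m n o = lemma m n (m ^ o) (n ^ o)
  where
  lemma : ∀ m n x y → m * n * (x * y) ≡ m * x * (n * y)
  lemma = solve-∀

^-reflectˡ-< : ∀ {m n} e → m ^ e < n ^ e → m < n
^-reflectˡ-< {m} {n} e mᵉ<nᵉ with m <? n
... | yes m<n = m<n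
... | no  m≮n = contradiction mᵉ<nᵉ (≤⇒≯ (^-monoˡ-≤ e (≮⇒≥ m≮n)))

n<2^n : ∀ n → n < 2 ^ n
n<2^n zero    = z<s
n<2^n (suc n) = +-mono-≤-< (m^n>0 2 n) (subst (n <_) (sym (+-identityʳ (2 ^ n))) (n<2^n n))

bernoulli : ∀ c k → c ^ k * (c + suc k) ≤ suc c ^ suc k
bernoulli c zero = ≤-reflexive (lemma c)
  where
  lemma : ∀ c → 1 * (c + 1) ≡ suc c * 1
  lemma = solve-∀
bernoulli c (suc k) = begin
  c ^ suc k * (c + suc (suc k))           ≡⟨ lemma₁ c (c ^ k) k ⟩
  c ^ k * (c * (c + suc (suc k)))         ≤⟨ *-monoʳ-≤ (c ^ k) (m≤m+n _ (suc k)) ⟩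
  c ^ k * (c * (c + suc (suc k)) + suc k) ≡⟨ lemma₂ c (c ^ k) k ⟩
  suc c * (c ^ k * (c + suc k))           ≤⟨ *-monoʳ-≤ (suc c) (bernoulli c k) ⟩
  suc c * suc c ^ suc k                   ∎
  where
  open ≤-Reasoning
  lemma₁ : ∀ c x k → c * x * (c + suc (suc k)) ≡ x * (c * (c + suc (suc k)))
  lemma₁ = solve-∀
  lemma₂ : ∀ c x k → x * (c * (c + suc (suc k)) + suc k) ≡ suc c * (x * (c + suc k))
  lemma₂ = solve-∀

-- Bernoulli's inequality (1 + 1/c)^R ≥ 1 + R/c exceeds c(c+1) once R > c²(c+1).
gapExponent : ℕ → ℕ
gapExponent c = suc (c * c * suc c)

^-gap : ∀ c → .{{NonZero c}} → c ^ suc (gapExponent c) * suc c < suc c ^ gapExponent c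
^-gap c = begin-strict
  c ^ suc (suc K) * suc c ≡⟨ lemma c (c ^ K) ⟩
  c ^ K * K               <⟨ *-monoʳ-< (c ^ K) {{m^n≢0 c K}} (m<n+m K (m≤n+m 1 c)) ⟩
  c ^ K * (c + 1 + K)     ≡⟨ cong (c ^ K *_) (+-assoc c 1 K) ⟩
  c ^ K * (c + suc K)     ≤⟨ bernoulli c K ⟩
  suc c ^ suc K           ∎
  where
  open ≤-Reasoning
  K = c * c * suc c
  lemma : ∀ c x → c * (c * x) * suc c ≡ x * (c * c * suc c)
  lemma = solve-∀

^-gap-amplify : ∀ c R L → c ^ suc R * suc c < suc c ^ R → R ≤ L →
                c ^ (suc R * suc L) < suc c ^ (R * L)
^-gap-amplify c R L gap R≤L = *-cancelʳ-< (suc c ^ suc L) _ _ (begin-strict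
  c ^ (suc R * suc L) * suc c ^ suc L   ≡⟨ cong (_* suc c ^ suc L) (sym (^-*-assoc c (suc R) (suc L))) ⟩
  (c ^ suc R) ^ suc L * suc c ^ suc L   ≡⟨ sym (^-distribʳ-* (c ^ suc R) (suc c) (suc L)) ⟩
  (c ^ suc R * suc c) ^ suc L           <⟨ ^-monoˡ-< (suc L) gap ⟩
  (suc c ^ R) ^ suc L                   ≡⟨ ^-*-assoc (suc c) R (suc L) ⟩
  suc c ^ (R * suc L)                   ≡⟨ cong (suc c ^_) (*-suc R L) ⟩
  suc c ^ (R + R * L)                   ≡⟨ ^-distribˡ-+-* (suc c) R (R * L) ⟩
  suc c ^ R * suc c ^ (R * L)           ≤⟨ *-monoˡ-≤ _ (^-monoʳ-≤ (suc c) (m≤n⇒m≤1+n R≤L)) ⟩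
  suc c ^ suc L * suc c ^ (R * L)       ≡⟨ *-comm (suc c ^ suc L) _ ⟩
  suc c ^ (R * L) * suc c ^ suc L       ∎)
  where open ≤-Reasoning

4*m*n≤[m+n]² : ∀ m n → 4 * (m * n) ≤ (m + n) * (m + n)
4*m*n≤[m+n]² m n = [ ordered , (λ n≤m → subst₂ (λ u v → 4 * u ≤ v * v) (*-comm n m) (+-comm n m) (ordered n≤m)) ]′
                     (≤-total m n)
  where
  ordered : ∀ {m n} → m ≤ n → 4 * (m * n) ≤ (m + n) * (m + n)
  ordered {m} {n} m≤n rewrite sym (m+[n∸m]≡n m≤n) = subst (4 * (m * (m + d)) ≤_) (square m d) (m≤m+n _ (d * d))
    where
    d = n ∸ m
    square : ∀ m d → 4 * (m * (m + d)) + d * d ≡ (m + (m + d)) * (m + (m + d))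
    square = solve-∀

m+n<o+o⇒m*n<o*o : ∀ m n o → m + n < o + o → m * n < o * o
m+n<o+o⇒m*n<o*o m n o m+n<2o = *-cancelˡ-< 4 _ _ (begin-strict
  4 * (m * n)       ≤⟨ 4*m*n≤[m+n]² m n ⟩
  (m + n) * (m + n) <⟨ *-mono-< m+n<2o m+n<2o ⟩
  (o + o) * (o + o) ≡⟨ lemma o ⟩
  4 * (o * o)       ∎)
  where
  open ≤-Reasoning
  lemma : ∀ o → (o + o) * (o + o) ≡ 4 * (o * o)
  lemma = solve-∀

prodBelow : (ℕ → ℕ) → ℕ → ℕ
prodBelow f zero    = 1
prodBelow f (suc n) = f n * prodBelow f n

prodBelow-cong : ∀ {f g} n → (∀ d → d < n → f d ≡ g d) → prodBelow f n ≡ prodBelow g n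
prodBelow-cong zero    f≡g = refl
prodBelow-cong (suc n) f≡g = cong₂ _*_ (f≡g n ≤-refl) (prodBelow-cong n (λ d d<n → f≡g d (m<n⇒m<1+n d<n)))

prodBelow-mono-≤ : ∀ {f g} n → (∀ d → d < n → f d ≤ g d) → prodBelow f n ≤ prodBelow g n
prodBelow-mono-≤ zero    f≤g = ≤-refl
prodBelow-mono-≤ (suc n) f≤g = *-mono-≤ (f≤g n ≤-refl) (prodBelow-mono-≤ n (λ d d<n → f≤g d (m<n⇒m<1+n d<n)))

prodBelow-<-^ : ∀ {f c} n → .{{NonZero n}} → (∀ d → d < n → f d < c) → prodBelow f n < c ^ n
prodBelow-<-^ {f} {c} (suc zero)      f<c = subst₂ _<_ (sym (*-identityʳ (f 0))) (sym (*-identityʳ c)) (f<c 0 ≤-refl)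
prodBelow-<-^ {f} {c} (suc n@(suc _)) f<c =
  *-mono-< (f<c n ≤-refl) (prodBelow-<-^ n (λ d d<n → f<c d (m<n⇒m<1+n d<n)))

prodBelow-* : ∀ f g n → prodBelow f n * prodBelow g n ≡ prodBelow (λ d → f d * g d) n
prodBelow-* f g zero    = refl
prodBelow-* f g (suc n) rewrite sym (prodBelow-* f g n) = lemma (f n) (g n) (prodBelow f n) (prodBelow g n)
  where
  lemma : ∀ a b x y → a * x * (b * y) ≡ a * b * (x * y)
  lemma = solve-∀

prodBelow-^ : ∀ f n e → prodBelow f n ^ e ≡ prodBelow (λ d → f d ^ e) n
prodBelow-^ f zero    e = ^-zeroˡ e
prodBelow-^ f (suc n) e = trans (^-distribʳ-* (f n) (prodBelow f n) e) (cong (f n ^ e *_) (prodBelow-^ f n e))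

prodBelow-suc : ∀ f n → prodBelow f (suc n) ≡ prodBelow (λ d → f (suc d)) n * f 0
prodBelow-suc f zero    = *-comm (f 0) 1
prodBelow-suc f (suc n) = begin
  f (suc n) * (f n * prodBelow f n)                   ≡⟨ cong (f (suc n) *_) (prodBelow-suc f n) ⟩
  f (suc n) * (prodBelow (λ d → f (suc d)) n * f 0)   ≡⟨ sym (*-assoc (f (suc n)) _ (f 0)) ⟩
  f (suc n) * prodBelow (λ d → f (suc d)) n * f 0     ∎
  where open ≡-Reasoning

prodBelow-reverse : ∀ f n → prodBelow f n ≡ prodBelow (λ d → f (n ∸ suc d)) n
prodBelow-reverse f zero    = refl
prodBelow-reverse f (suc n) = begin
  prodBelow f (suc n)                                  ≡⟨ prodBelow-suc f n ⟩
  prodBelow (λ d → f (suc d)) n * f 0                  ≡⟨ cong (_* f 0) (prodBelow-reverse (λ d → f (suc d)) n) ⟩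
  prodBelow (λ d → f (suc (n ∸ suc d))) n * f 0        ≡⟨ cong (_* f 0) (prodBelow-cong n (λ d d<n → cong f (sym (+-∸-assoc 1 d<n)))) ⟩
  prodBelow (λ d → f (n ∸ d)) n * f 0                  ≡⟨ *-comm _ (f 0) ⟩
  f 0 * prodBelow (λ d → f (n ∸ d)) n                  ≡⟨ cong (λ z → f z * prodBelow (λ d → f (n ∸ d)) n) (sym (n∸n≡0 n)) ⟩
  f (n ∸ n) * prodBelow (λ d → f (n ∸ d)) n            ∎
  where open ≡-Reasoning

prodBelow[d+t]<n^n : ∀ n t → .{{NonZero n}} → 2 * t ≤ n → prodBelow (λ d → d + t) n < n ^ n
prodBelow[d+t]<n^n n t 2t≤n = ^-reflectˡ-< 2 (begin-strict
  P ^ 2                                               ≡⟨ cong (P *_) (*-identityʳ P) ⟩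
  P * P                                               ≡⟨ cong (P *_) (prodBelow-reverse g n) ⟩
  P * prodBelow (λ d → g (n ∸ suc d)) n               ≡⟨ prodBelow-* g _ n ⟩
  prodBelow (λ d → g d * g (n ∸ suc d)) n             <⟨ prodBelow-<-^ n pair-< ⟩
  (n * n) ^ n                                         ≡⟨ ^-distribʳ-* n n n ⟩
  n ^ n * n ^ n                                       ≡⟨ cong (n ^ n *_) (sym (*-identityʳ (n ^ n))) ⟩
  (n ^ n) ^ 2                                         ∎)
  where
  open ≤-Reasoning
  g : ℕ → ℕ
  g d = d + t
  P = prodBelow g n
  pair-< : ∀ d → d < n → g d * g (n ∸ suc d) < n * n
  pair-< d d<n = m+n<o+o⇒m*n<o*o (g d) (g (n ∸ suc d)) n (begin-strict
    d + t + (n ∸ suc d + t)     <⟨ n<1+n _ ⟩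
    suc (d + t + (n ∸ suc d + t)) ≡⟨ lemma d t (n ∸ suc d) ⟩
    suc d + (n ∸ suc d) + 2 * t ≡⟨ cong (_+ 2 * t) (m+[n∸m]≡n d<n) ⟩
    n + 2 * t                   ≤⟨ +-monoʳ-≤ n 2t≤n ⟩
    n + n                       ∎)
    where
    lemma : ∀ d t r → suc (d + t + (r + t)) ≡ suc d + r + 2 * t
    lemma = solve-∀

count-head : ∀ x xs → count x (x ∷ xs) ≡ suc (count x xs)
count-head x xs with x ≟ x
... | yes _  = refl
... | no x≢x = contradiction refl x≢x

count-other : ∀ {x d} xs → x ≢ d → count d (x ∷ xs) ≡ count d xs
count-other {x} {d} xs x≢d with x ≟ d
... | yes x≡d = contradiction x≡d x≢d
... | no  _   = refl

prodBelow-update : ∀ {f g} a x n → x < n → f x ≡ a * g x → (∀ d → d ≢ x → f d ≡ g d) →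
                   prodBelow f n ≡ a * prodBelow g n
prodBelow-update {f} {g} a x (suc n) x<1+n fx other with m<1+n⇒m<n∨m≡n x<1+n
... | inj₁ x<n = begin
  f n * prodBelow f n        ≡⟨ cong₂ _*_ (other n (>⇒≢ x<n)) (prodBelow-update a x n x<n fx other) ⟩
  g n * (a * prodBelow g n)  ≡⟨ x∙yz≈y∙xz (g n) a _ ⟩
  a * (g n * prodBelow g n)  ∎
  where open ≡-Reasoning
... | inj₂ refl = begin
  f x * prodBelow f x        ≡⟨ cong₂ _*_ fx (prodBelow-cong x (λ d d<x → other d (<⇒≢ d<x))) ⟩
  a * g x * prodBelow g x    ≡⟨ *-assoc a (g x) _ ⟩
  a * (g x * prodBelow g x)  ∎
  where open ≡-Reasoning

foldr-*≡prodBelow-^-count : ∀ (g : ℕ → ℕ) n xs → All (_< n) xs →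
                            foldr (λ d r → g d * r) 1 xs ≡ prodBelow (λ d → g d ^ count d xs) n
foldr-*≡prodBelow-^-count g n []       []          = prodBelow-^ g n 0
foldr-*≡prodBelow-^-count g n (x ∷ xs) (x<n ∷ xs<n) = begin
  g x * foldr (λ d r → g d * r) 1 xs            ≡⟨ cong (g x *_) (foldr-*≡prodBelow-^-count g n xs xs<n) ⟩
  g x * prodBelow (λ d → g d ^ count d xs) n    ≡⟨ sym (prodBelow-update (g x) x n x<n head other) ⟩
  prodBelow (λ d → g d ^ count d (x ∷ xs)) n    ∎
  where
  open ≡-Reasoning
  head : g x ^ count x (x ∷ xs) ≡ g x * g x ^ count x xs
  head = cong (g x ^_) (count-head x xs)
  other : ∀ d → d ≢ x → g d ^ count d (x ∷ xs) ≡ g d ^ count d xs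
  other d d≢x = cong (g d ^_) (count-other xs (d≢x ∘ sym))

foldr-*-^-≤ : ∀ (g : ℕ → ℕ) n xs K E → All (_< n) xs → (∀ d → d < n → NonZero (g d)) →
              (∀ d → d < n → count d xs * K ≤ E) →
              foldr (λ d r → g d * r) 1 xs ^ K ≤ prodBelow g n ^ E
foldr-*-^-≤ g n xs K E xs<n g≢0 counts = begin
  foldr (λ d r → g d * r) 1 xs ^ K              ≡⟨ cong (_^ K) (foldr-*≡prodBelow-^-count g n xs xs<n) ⟩
  prodBelow (λ d → g d ^ count d xs) n ^ K      ≡⟨ prodBelow-^ _ n K ⟩
  prodBelow (λ d → (g d ^ count d xs) ^ K) n    ≡⟨ prodBelow-cong n (λ d _ → ^-*-assoc (g d) (count d xs) K) ⟩
  prodBelow (λ d → g d ^ (count d xs * K)) n    ≤⟨ prodBelow-mono-≤ n (λ d d<n → ^-monoʳ-≤ (g d) {{g≢0 d d<n}} (counts d d<n)) ⟩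
  prodBelow (λ d → g d ^ E) n                   ≡⟨ sym (prodBelow-^ g n E) ⟩
  prodBelow g n ^ E                             ∎
  where open ≤-Reasoning

p≤∣p∣ : ∀ p → p ℚ.≤ ℚ.∣ p ∣
p≤∣p∣ (ℚ.mkℚ (ℤ.+ _)    _ _) = ℚ.≤-refl
p≤∣p∣ (ℚ.mkℚ ℤ.-[1+ _ ] _ _) = ℚ.*≤* ℤ.-≤+

∣p-q∣<r⇒p<r+q : ∀ p q r → ℚ.∣ p ℚ.- q ∣ ℚ.< r → p ℚ.< r ℚ.+ q
∣p-q∣<r⇒p<r+q p q r ∣p-q∣<r = subst (ℚ._< r ℚ.+ q) p-q+q≡p (ℚ.+-monoˡ-< q (ℚ.≤-<-trans (p≤∣p∣ (p ℚ.- q)) ∣p-q∣<r))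
  where
  p-q+q≡p : p ℚ.- q ℚ.+ q ≡ p
  p-q+q≡p = trans (ℚ.+-assoc p (ℚ.- q) q) (trans (cong (p ℚ.+_) (ℚ.+-inverseˡ q)) (ℚ.+-identityʳ p))

ratio≃ : ∀ c n → ℚ.toℚᵘ (ratio c (suc n)) ℚᵘ.≃ ℚᵘ.mkℚᵘ (ℤ.+ c) n
ratio≃ c n = ℚ.toℚᵘ-fromℚᵘ (ℚᵘ.mkℚᵘ (ℤ.+ c) n)

ratio-close⇒< : ∀ c n q e → ℚ.∣ ratio c (suc n) ℚ.- ratio 1 (suc q) ∣ ℚ.< ratio 1 (suc e) →
                c * (suc e * suc q) < (suc q + suc e) * suc n
ratio-close⇒< c n q e close = subst (λ z → c * (suc e * suc q) < z * suc n)
                                      (cong₂ _+_ (*-identityˡ (suc q)) (*-identityˡ (suc e))) (fromℤ cross)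
  where
  sum≃ : ℚ.toℚᵘ (ratio 1 (suc e) ℚ.+ ratio 1 (suc q)) ℚᵘ.≃ ℚᵘ.mkℚᵘ (ℤ.+ 1) e ℚᵘ.+ ℚᵘ.mkℚᵘ (ℤ.+ 1) q
  sum≃ = ℚᵘ.≃-trans (ℚ.toℚᵘ-homo-+ (ratio 1 (suc e)) (ratio 1 (suc q))) (ℚᵘ.+-cong (ratio≃ 1 e) (ratio≃ 1 q))
  below : ℚᵘ.mkℚᵘ (ℤ.+ c) n ℚᵘ.< ℚᵘ.mkℚᵘ (ℤ.+ 1) e ℚᵘ.+ ℚᵘ.mkℚᵘ (ℤ.+ 1) q
  below = ℚᵘ.<-respʳ-≃ sum≃ (ℚᵘ.<-respˡ-≃ (ratio≃ c n) (ℚ.toℚᵘ-mono-< (∣p-q∣<r⇒p<r+q _ _ _ close)))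
  cross : ℤ.+ c ℤ.* ℤ.+ (suc e * suc q) ℤ.< (ℤ.+ (1 * suc q) ℤ.+ ℤ.+ (1 * suc e)) ℤ.* ℤ.+ (suc n)
  cross = ℚᵘ.drop-*<* below
  fromℤ : ℤ.+ c ℤ.* ℤ.+ (suc e * suc q) ℤ.< (ℤ.+ (1 * suc q) ℤ.+ ℤ.+ (1 * suc e)) ℤ.* ℤ.+ (suc n) →
          c * (suc e * suc q) < (1 * suc q + 1 * suc e) * suc n
  fromℤ lt rewrite sym (ℤ.pos-* c (suc e * suc q)) | sym (ℤ.pos-+ (1 * suc q) (1 * suc e))
                 | sym (ℤ.pos-* (1 * suc q + 1 * suc e) (suc n)) = ℤ.drop‿+<+ lt

-- The base is written 2 + k so that digitsAux, which matches on its base, unfolds.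
module Digits (k : ℕ) where

  b : ℕ
  b = 2 + k

  private
    quotient-< : ∀ m → suc m / b < suc m
    quotient-< m = m/n<m (suc m) b (s≤s (s≤s z≤n))

    quotient-fuel : ∀ {f m} → suc m ≤ suc f → suc m / b ≤ f
    quotient-fuel {m = m} (s≤s m≤f) = ≤-trans (s≤s⁻¹ (quotient-< m)) m≤f

    b*[x/b]≤x : ∀ x → b * (x / b) ≤ x
    b*[x/b]≤x x = subst (_≤ x) (*-comm (x / b) b) (m/n*n≤m x b)

    x<b*[1+x/b] : ∀ x → x < b * suc (x / b)
    x<b*[1+x/b] x = begin-strict
      x                 ≡⟨ m≡m%n+[m/n]*n x b ⟩
      x % b + x / b * b <⟨ +-monoˡ-< _ (m%n<n x b) ⟩
      suc (x / b) * b   ≡⟨ *-comm (suc (x / b)) b ⟩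
      b * suc (x / b)   ∎
      where open ≤-Reasoning

  digitsAux-zero : ∀ f → digitsAux f b 0 ≡ []
  digitsAux-zero zero    = refl
  digitsAux-zero (suc f) = refl

  digitsAux-fuel : ∀ f g x → x ≤ f → x ≤ g → digitsAux f b x ≡ digitsAux g b x
  digitsAux-fuel f       g       zero    _    _    = trans (digitsAux-zero f) (sym (digitsAux-zero g))
  digitsAux-fuel (suc f) (suc g) (suc m) x≤1+f x≤1+g =
    cong (suc m % b ∷_) (digitsAux-fuel f g (suc m / b) (quotient-fuel x≤1+f) (quotient-fuel x≤1+g))

  digits-< : ∀ x → All (_< b) (digits b x)
  digits-< zero    = z<s ∷ []
  digits-< (suc m) = go (suc m) (suc m)
    where
    go : ∀ f x → All (_< b) (digitsAux f b x)
    go zero    x       = []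
    go (suc f) zero    = []
    go (suc f) (suc m) = m%n<n (suc m) b ∷ go f (suc m / b)

  digits-length : ∀ x → .{{NonZero x}} →
                  ∃[ L ] (length (digits b x) ≡ suc L × b ^ L ≤ x × x < b ^ suc L)
  digits-length (suc m) = go (suc m) (suc m) ≤-refl
    where
    go : ∀ f x → .{{NonZero x}} → x ≤ f →
         ∃[ L ] (length (digitsAux f b x) ≡ suc L × b ^ L ≤ x × x < b ^ suc L)
    go (suc f) x@(suc m) x≤1+f with x / b in q≡
    ... | zero  = 0 , cong (λ ds → suc (length ds)) (digitsAux-zero f) , s≤s z≤n
                , subst (x <_) (sym (*-identityʳ b)) (m/n≡0⇒m<n q≡)
    ... | suc q with go f (suc q) (subst (_≤ f) q≡ (quotient-fuel x≤1+f))
    ...   | L , len , lo , hi = suc L , cong suc len , lo′ , hi′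
      where
      lo′ : b * b ^ L ≤ x
      lo′ = ≤-trans (*-monoʳ-≤ b lo) (subst (λ z → b * z ≤ x) q≡ (b*[x/b]≤x x))
      hi′ : x < b * (b * b ^ L)
      hi′ = <-≤-trans (subst (λ z → x < b * suc z) q≡ (x<b*[1+x/b] x)) (*-monoʳ-≤ b hi)

  digits-b* : ∀ y → .{{NonZero y}} → digits b (b * y) ≡ 0 ∷ digits b y
  digits-b* y@(suc y₀) = cong₂ _∷_ last rest
    where
    by≡ : b * y ≡ y * b
    by≡ = *-comm b y
    last : (b * y) % b ≡ 0
    last = trans (cong (_% b) by≡) (m*n%n≡0 y b)
    quotient : (b * y) / b ≡ y
    quotient = trans (cong (_/ b) by≡) (m*n/n≡m y b)
    y<by : y < b * y
    y<by = subst (y <_) (sym by≡) (m<m*n y b (s≤s (s≤s z≤n)))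
    rest : digitsAux (pred (b * y)) b ((b * y) / b) ≡ digitsAux y b y
    rest = trans (cong (digitsAux (pred (b * y)) b) quotient)
                 (digitsAux-fuel (pred (b * y)) y y (s≤s⁻¹ y<by) ≤-refl)

  S-b* : ∀ t y → .{{NonZero y}} → S t b (b * y) ≡ t * S t b y
  S-b* t y = cong (foldr (λ d r → (d + t) * r) 1) (digits-b* y)

  S-b^* : ∀ t j y → .{{NonZero y}} → S t b (b ^ j * y) ≡ t ^ j * S t b y
  S-b^* t zero    y = trans (cong (S t b) (*-identityˡ y)) (sym (*-identityˡ _))
  S-b^* t (suc j) y = begin
    S t b (b * b ^ j * y)   ≡⟨ cong (S t b) (*-assoc b (b ^ j) y) ⟩
    S t b (b * (b ^ j * y)) ≡⟨ S-b* t (b ^ j * y) {{m*n≢0 (b ^ j) y {{m^n≢0 b j}}}} ⟩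
    t * S t b (b ^ j * y)   ≡⟨ cong (t *_) (S-b^* t j y) ⟩
    t * (t ^ j * S t b y)   ≡⟨ sym (*-assoc t _ _) ⟩
    t * t ^ j * S t b y     ∎
    where open ≡-Reasoning

  S-zero-≤ : ∀ x → S 0 b x ≤ x
  S-zero-≤ zero    = z≤n
  S-zero-≤ (suc m) = go (suc m) m ≤-refl
    where
    P : List ℕ → ℕ
    P = foldr (λ d r → (d + 0) * r) 1
    go : ∀ f m → suc m ≤ f → P (digitsAux f b (suc m)) ≤ suc m
    go (suc f) m x≤1+f with suc m / b in q≡
    ... | zero  rewrite digitsAux-zero f =
      ≤-trans (≤-reflexive (trans (*-identityʳ _) (+-identityʳ _))) (m%n≤m (suc m) b)
    ... | suc q = begin
      (x % b + 0) * P (digitsAux f b (suc q)) ≤⟨ *-monoʳ-≤ (x % b + 0) (go f q (subst (_≤ f) q≡ (quotient-fuel x≤1+f))) ⟩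
      (x % b + 0) * suc q                      ≤⟨ *-monoˡ-≤ (suc q) (<⇒≤ (subst (_< b) (sym (+-identityʳ (x % b))) (m%n<n x b))) ⟩
      b * suc q                                ≤⟨ subst (λ z → b * z ≤ x) q≡ (b*[x/b]≤x x) ⟩
      x                                        ∎
      where
      open ≤-Reasoning
      x = suc m

module Contraction (k : ℕ) where

  open Digits k

  opaque
    c : ℕ
    c = pred (b ^ b)

    suc-c : suc c ≡ b ^ b
    suc-c = suc-pred (b ^ b) {{m^n≢0 b b}}

  instance
    c≢0 : NonZero c
    c≢0 = >-nonZero (s≤s⁻¹ (begin-strict
      1       <⟨ s≤s (s≤s z≤n) ⟩
      b       ≡⟨ sym (*-identityʳ b) ⟩
      b ^ 1   ≤⟨ ^-monoʳ-≤ b {1} {b} (s≤s z≤n) ⟩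
      b ^ b   ≡⟨ sym suc-c ⟩
      suc c   ∎))
      where open ≤-Reasoning

  R : ℕ
  R = gapExponent c

  equidistributed⇒S< : ∀ t → .{{NonZero t}} → 2 * t ≤ b → ∀ m → .{{NonZero m}} → b ^ R ≤ m →
                       Equidistributed (ratio 1 (b * R)) b m → S t b m < m
  equidistributed⇒S< t 2t≤b m bᴿ≤m equi with digits-length m
  ... | L , len , bᴸ≤m , m<bᴸ⁺¹ = ^-reflectˡ-< (b * R) (begin-strict
    S t b m ^ (b * R)          ≤⟨ foldr-*-^-≤ (λ d → d + t) b (digits b m) (b * R) (suc R * suc L) (digits-< m) shift≢0 counts ⟩
    P ^ (suc R * suc L)        ≤⟨ ^-monoˡ-≤ (suc R * suc L) P≤c ⟩
    c ^ (suc R * suc L)        <⟨ ^-gap-amplify c R L (^-gap c) R≤L ⟩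
    suc c ^ (R * L)            ≡⟨ cong (_^ (R * L)) suc-c ⟩
    (b ^ b) ^ (R * L)          ≡⟨ ^-*-assoc b b (R * L) ⟩
    b ^ (b * (R * L))          ≡⟨ cong (b ^_) (lemma b R L) ⟩
    b ^ (L * (b * R))          ≡⟨ sym (^-*-assoc b L (b * R)) ⟩
    (b ^ L) ^ (b * R)          ≤⟨ ^-monoˡ-≤ (b * R) bᴸ≤m ⟩
    m ^ (b * R)                ∎)
    where
    open ≤-Reasoning
    P = prodBelow (λ d → d + t) b
    P≤c : P ≤ c
    P≤c = s≤s⁻¹ (subst (P <_) (sym suc-c) (prodBelow[d+t]<n^n b t 2t≤b))
    shift≢0 : ∀ d → d < b → NonZero (d + t)
    shift≢0 d _ = >-nonZero (≤-trans (>-nonZero⁻¹ t) (m≤n+m t d))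
    R≤L : R ≤ L
    R≤L with R ≤? L
    ... | yes R≤L = R≤L
    ... | no  R≰L = contradiction bᴿ≤m (<⇒≱ (<-≤-trans m<bᴸ⁺¹ (^-monoʳ-≤ b (≰⇒> R≰L))))
    counts : ∀ d → d < b → count d (digits b m) * (b * R) ≤ suc R * suc L
    counts d d<b = <⇒≤ (*-cancelˡ-< b _ _ (subst₂ _<_ (lemma₁ (count d (digits b m)) b R) (lemma₂ b R (suc L)) cross))
      where
      close : ℚ.∣ ratio (count d (digits b m)) (suc L) ℚ.- ratio 1 b ∣ ℚ.< ratio 1 (b * R)
      close = subst (λ n → ℚ.∣ ratio (count d (digits b m)) n ℚ.- ratio 1 b ∣ ℚ.< ratio 1 (b * R)) len (equi d d<b)
      cross : count d (digits b m) * (b * R * b) < (b + b * R) * suc L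
      cross = ratio-close⇒< (count d (digits b m)) L (suc k) _ close
      lemma₁ : ∀ x b R → x * (b * R * b) ≡ b * (x * (b * R))
      lemma₁ = solve-∀
      lemma₂ : ∀ b R L → (b + b * R) * L ≡ b * (suc R * L)
      lemma₂ = solve-∀
    lemma : ∀ b R L → b * (R * L) ≡ L * (b * R)
    lemma = solve-∀

prodFin-cong : ∀ k {f g : Fin k → ℕ} → (∀ i → f i ≡ g i) → prodFin k f ≡ prodFin k g
prodFin-cong zero    f≡g = refl
prodFin-cong (suc k) f≡g = cong₂ _*_ (f≡g zero) (prodFin-cong k (f≡g ∘ suc))

prodFin-mono-≤ : ∀ k {f g : Fin k → ℕ} → (∀ i → f i ≤ g i) → prodFin k f ≤ prodFin k g
prodFin-mono-≤ zero    f≤g = ≤-refl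
prodFin-mono-≤ (suc k) f≤g = *-mono-≤ (f≤g zero) (prodFin-mono-≤ k (f≤g ∘ suc))

prodFin-nonZero : ∀ k {f : Fin k → ℕ} → (∀ i → NonZero (f i)) → NonZero (prodFin k f)
prodFin-nonZero zero    f≢0 = _
prodFin-nonZero (suc k) f≢0 = m*n≢0 _ _ {{f≢0 zero}} {{prodFin-nonZero k (f≢0 ∘ suc)}}

prodFin-one : ∀ k → prodFin k (λ _ → 1) ≡ 1
prodFin-one zero    = refl
prodFin-one (suc k) = trans (*-identityˡ _) (prodFin-one k)

prodFin-* : ∀ k (f g : Fin k → ℕ) → prodFin k f * prodFin k g ≡ prodFin k (λ i → f i * g i)
prodFin-* zero    f g = refl
prodFin-* (suc k) f g rewrite sym (prodFin-* k (f ∘ suc) (g ∘ suc)) =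
  lemma (f zero) (g zero) (prodFin k (f ∘ suc)) (prodFin k (g ∘ suc))
  where
  lemma : ∀ a b x y → a * x * (b * y) ≡ a * b * (x * y)
  lemma = solve-∀

prodFin-^-+ : ∀ k (f α β : Fin k → ℕ) →
              prodFin k (λ i → f i ^ α i) * prodFin k (λ i → f i ^ β i) ≡ prodFin k (λ i → f i ^ (α i + β i))
prodFin-^-+ k f α β = trans (prodFin-* k _ _) (prodFin-cong k (λ i → sym (^-distribˡ-+-* (f i) (α i) (β i))))

indicator : ∀ {k} → Fin k → Fin k → ℕ
indicator zero    zero    = 1
indicator zero    (suc _) = 0
indicator (suc _) zero    = 0
indicator (suc j) (suc i) = indicator j i

prodFin-^-indicator : ∀ k (f : Fin k → ℕ) j → prodFin k (λ i → f i ^ indicator j i) ≡ f j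
prodFin-^-indicator (suc k) f zero    = trans (cong₂ _*_ (*-identityʳ (f zero)) (prodFin-one k)) (*-identityʳ (f zero))
prodFin-^-indicator (suc k) f (suc j) = trans (*-identityˡ _) (prodFin-^-indicator k (f ∘ suc) j)

lookup-injective : ∀ {xs : List ℕ} → Unique xs → Injective _≡_ _≡_ (lookup xs)
lookup-injective (_    ∷ _)  {zero}  {zero}  _  = refl
lookup-injective (x∉xs ∷ _)  {zero}  {suc j} eq = contradiction eq (All.lookup x∉xs (∈-lookup j))
lookup-injective (x∉xs ∷ _)  {suc i} {zero}  eq = contradiction (sym eq) (All.lookup x∉xs (∈-lookup i))
lookup-injective (_    ∷ xs!) {suc i} {suc j} eq = cong suc (lookup-injective xs! eq)

module Generators (b : ℕ) where

  Admissible : ℕ → Set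
  Admissible q = Prime q × q ≢ b

  admissible? : Decidable Admissible
  admissible? q = prime? q ×-dec ¬? (q ≟ b)

  opaque
    primes : List ℕ
    primes = filter admissible? (upTo (b + b))

    #primes : ℕ
    #primes = length primes

    prime : Fin #primes → ℕ
    prime = lookup primes

    prime-admissible : ∀ i → Admissible (prime i)
    prime-admissible i = proj₂ (∈-filter⁻ admissible? {xs = upTo (b + b)} (∈-lookup i))

    prime-injective : Injective _≡_ _≡_ prime
    prime-injective = lookup-injective (filter⁺ admissible? (upTo⁺ (b + b)))

    prime-surjective : ∀ q → Admissible q → q < b + b → ∃[ i ] prime i ≡ q
    prime-surjective q q-admissible q<2b = index q∈primes , sym (lookup-index q∈primes)
      where
      q∈primes : q ∈ primes
      q∈primes = ∈-filter⁺ admissible? (∈-upTo⁺ q<2b) q-admissible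

  prime≢0 : ∀ i → NonZero (prime i)
  prime≢0 i = prime⇒nonZero (proj₁ (prime-admissible i))

  Generated : ℕ → Set
  Generated x = ∃[ j ] Σ (Fin #primes → ℕ) λ α → x ≡ b ^ j * prodFin #primes (λ i → prime i ^ α i)

  generated-1 : Generated 1
  generated-1 = 0 , (λ _ → 0) , sym (trans (*-identityˡ _) (prodFin-one #primes))

  generated-* : ∀ {x y} → Generated x → Generated y → Generated (x * y)
  generated-* {x} {y} (j , α , x≡) (j′ , β , y≡) = j + j′ , (λ i → α i + β i) , (begin
    x * y                                                    ≡⟨ cong₂ _*_ x≡ y≡ ⟩
    b ^ j * Pα * (b ^ j′ * Pβ)                               ≡⟨ lemma (b ^ j) Pα (b ^ j′) Pβ ⟩
    b ^ j * b ^ j′ * (Pα * Pβ)                               ≡⟨ cong₂ _*_ (sym (^-distribˡ-+-* b j j′)) (prodFin-^-+ #primes prime α β) ⟩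
    b ^ (j + j′) * prodFin #primes (λ i → prime i ^ (α i + β i)) ∎)
    where
    open ≡-Reasoning
    Pα = prodFin #primes (λ i → prime i ^ α i)
    Pβ = prodFin #primes (λ i → prime i ^ β i)
    lemma : ∀ a x c y → a * x * (c * y) ≡ a * c * (x * y)
    lemma = solve-∀

  generated-prime : ∀ q → Prime q → q < b + b → Generated q
  generated-prime q q-prime q<2b with q ≟ b
  ... | yes refl = 1 , (λ _ → 0) , sym (trans (cong (q * 1 *_) (prodFin-one #primes)) (trans (*-identityʳ _) (*-identityʳ q)))
  ... | no  q≢b with prime-surjective q (q-prime , q≢b) q<2b
  ...   | i , prime-i≡q = 0 , indicator i , sym (trans (*-identityˡ _) (trans (prodFin-^-indicator #primes prime i) prime-i≡q))

  generated-product : ∀ xs → All Generated xs → Generated (product xs)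
  generated-product []       []       = generated-1
  generated-product (x ∷ xs) (g ∷ gs) = generated-* g (generated-product xs gs)

  generated-< : ∀ y → .{{NonZero y}} → y < b + b → Generated y
  generated-< y y<2b = subst Generated (sym isFactorisation) (generated-product factors (go factors (divides factors) factorsPrime))
    where
    open PrimeFactorisation (factorise y)
    divides : ∀ fs → All (_∣ product fs) fs
    divides []       = []
    divides (f ∷ fs) = m∣m*n (product fs) ∷ All.map (λ d → ∣-trans d (n∣m*n f)) (divides fs)
    go : ∀ zs → All (_∣ product factors) zs → All Prime zs → All Generated zs
    go []       []       []       = []
    go (z ∷ zs) (d ∷ ds) (pz ∷ pzs) =
      generated-prime z pz (≤-<-trans (∣⇒≤ (subst (z ∣_) (sym isFactorisation) d)) y<2b) ∷ go zs ds pzs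

bounded-orbit⇒periodic : ∀ (f : ℕ → ℕ) n B → (∀ k → iter f k n ≤ B) →
                         ∃[ k ] ∃[ p ] (0 < p × iter f (k + p) n ≡ iter f k n)
bounded-orbit⇒periodic f n B bounded with Fin.pigeonhole (n<1+n (suc B)) orbit
  where
  orbit : Fin (suc (suc B)) → Fin (suc B)
  orbit i = fromℕ< (s≤s (bounded (toℕ i)))
... | i , j , i<j , same = toℕ i , toℕ j ∸ toℕ i , m<n⇒0<n∸m i<j , (begin
  iter f (toℕ i + (toℕ j ∸ toℕ i)) n ≡⟨ cong (λ k → iter f k n) (m+[n∸m]≡n (<⇒≤ i<j)) ⟩
  iter f (toℕ j) n                   ≡⟨ sym (Fin.toℕ-fromℕ< _) ⟩
  toℕ (fromℕ< _)                     ≡⟨ cong toℕ (sym same) ⟩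
  toℕ (fromℕ< _)                     ≡⟨ Fin.toℕ-fromℕ< _ ⟩
  iter f (toℕ i) n                   ∎)
  where open ≡-Reasoning

maxBelow : (ℕ → ℕ) → ℕ → ℕ
maxBelow f zero    = 0
maxBelow f (suc n) = f n ⊔ maxBelow f n

≤-maxBelow : ∀ f {n y} → y < n → f y ≤ maxBelow f n
≤-maxBelow f {suc n} y<1+n with m<1+n⇒m<n∨m≡n y<1+n
... | inj₁ y<n  = ≤-trans (≤-maxBelow f y<n) (m≤n⊔m (f n) _)
... | inj₂ refl = m≤m⊔n (f n) _

descent⇒iter-bounded : ∀ (f : ℕ → ℕ) (P : ℕ → Set) M → (∀ x → P (f x)) → (∀ x → P x → M ≤ x → f x < x) →
                       ∀ n k → iter f k n ≤ n ⊔ (f n ⊔ maxBelow f M)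
descent⇒iter-bounded f P M P-image descent n = bound
  where
  B = n ⊔ (f n ⊔ maxBelow f M)
  step : ∀ x → P x → x ≤ B → f x ≤ B
  step x Px x≤B with M ≤? x
  ... | yes M≤x = <⇒≤ (<-≤-trans (descent x Px M≤x) x≤B)
  ... | no  M≰x = ≤-trans (≤-maxBelow f (≰⇒> M≰x)) (≤-trans (m≤n⊔m (f n) _) (m≤n⊔m n _))
  bound-suc : ∀ k → iter f (suc k) n ≤ B
  bound-suc zero    = ≤-trans (m≤m⊔n (f n) _) (m≤n⊔m n _)
  bound-suc (suc k) = step (iter f (suc k) n) (P-image (iter f k n)) (bound-suc k)
  bound : ∀ k → iter f k n ≤ B
  bound zero    = m≤m⊔n n _
  bound (suc k) = bound-suc k

decreasing⇒iter-≤ : ∀ (f : ℕ → ℕ) → (∀ x → f x ≤ x) → ∀ n k → iter f k n ≤ n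
decreasing⇒iter-≤ f f≤ n zero    = ≤-refl
decreasing⇒iter-≤ f f≤ n (suc k) = ≤-trans (f≤ (iter f k n)) (decreasing⇒iter-≤ f f≤ n k)

module Descent (conjectureB : ConjectureB) (k : ℕ) (b-prime : Prime (2 + k))
               (t : ℕ) .{{t≢0 : NonZero t}} (2t≤b : 2 * t ≤ 2 + k) where

  open Digits k
  open Contraction k
  open Generators b

  t≤b : t ≤ b
  t≤b = ≤-trans (m≤n*m t 2) 2t≤b

  S-generated : ∀ x → Generated (S t b x)
  S-generated x = go (digits b x) (digits-< x)
    where
    go : ∀ ds → All (_< b) ds → Generated (foldr (λ d r → (d + t) * r) 1 ds)
    go []       []          = generated-1
    go (d ∷ ds) (d<b ∷ ds<b) =
      generated-* (generated-< (d + t) {{>-nonZero (≤-trans (>-nonZero⁻¹ t) (m≤n+m t d))}} (+-mono-<-≤ d<b t≤b))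
                  (go ds ds<b)

  ε : ℚ.ℚ
  ε = ratio 1 (b * R)

  opaque
    equidistribution-threshold : ∃[ N ] (∀ (α : Fin #primes → ℕ) → (∃[ i ] (N ≤ α i)) →
                                   Equidistributed ε b (1 * prodFin #primes (λ i → prime i ^ α i)))
    equidistribution-threshold =
      conjectureB b (s≤s (s≤s z≤n)) #primes prime (proj₁ ∘ prime-admissible) prime-injective
                  (b , b-prime , ∣-refl , proj₂ ∘ prime-admissible) 1 z<s
                  ε (ℚ.positive⁻¹ ε {{ℚ.normalize-pos 1 (b * R)}})

  N : ℕ
  N = proj₁ equidistribution-threshold

  power : (Fin #primes → ℕ) → ℕ
  power α = prodFin #primes (λ i → prime i ^ α i)

  power≢0 : ∀ α → NonZero (power α)
  power≢0 α = prodFin-nonZero #primes (λ i → m^n≢0 (prime i) (α i) {{prime≢0 i}})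

  M₀ : ℕ
  M₀ = power (λ _ → N) + b ^ R

  S<-power : ∀ α → M₀ ≤ power α → S t b (power α) < power α
  S<-power α M₀≤m with Fin.any? (λ i → N ≤? α i)
  ... | yes large = equidistributed⇒S< t 2t≤b (power α) {{power≢0 α}} (≤-trans (m≤n+m (b ^ R) (power (λ _ → N))) M₀≤m)
                      (subst (Equidistributed ε b) (*-identityˡ (power α)) (proj₂ equidistribution-threshold α large))
  ... | no  small = contradiction M₀≤m (<⇒≱ (begin-strict
    power α        ≤⟨ prodFin-mono-≤ #primes (λ i → ^-monoʳ-≤ (prime i) {{prime≢0 i}} (<⇒≤ (≰⇒> (λ N≤α → small (i , N≤α))))) ⟩
    power (λ _ → N) <⟨ m<m+n (power (λ _ → N)) (m^n>0 b R) ⟩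
    M₀             ∎))
    where open ≤-Reasoning

  K₀ : ℕ
  K₀ = maxBelow (S t b) M₀

  M : ℕ
  M = M₀ * b ^ K₀

  exponent-large : ∀ j m → M ≤ b ^ j * m → m < M₀ → K₀ < j
  exponent-large j m M≤x m<M₀ with K₀ <? j
  ... | yes K₀<j = K₀<j
  ... | no  K₀≮j = contradiction M≤x (<⇒≱ (begin-strict
    b ^ j * m    ≤⟨ *-monoˡ-≤ m (^-monoʳ-≤ b (≮⇒≥ K₀≮j)) ⟩
    b ^ K₀ * m   <⟨ *-monoʳ-< (b ^ K₀) {{m^n≢0 b K₀}} m<M₀ ⟩
    b ^ K₀ * M₀  ≡⟨ *-comm (b ^ K₀) M₀ ⟩
    M            ∎))
    where open ≤-Reasoning

  S<-generated : ∀ x → Generated x → M ≤ x → S t b x < x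
  S<-generated x (j , α , refl) M≤x with M₀ ≤? power α
  ... | yes M₀≤m = begin-strict
    S t b (b ^ j * m)   ≡⟨ S-b^* t j m {{power≢0 α}} ⟩
    t ^ j * S t b m     ≤⟨ *-monoˡ-≤ (S t b m) (^-monoˡ-≤ j t≤b) ⟩
    b ^ j * S t b m     <⟨ *-monoʳ-< (b ^ j) {{m^n≢0 b j}} (S<-power α M₀≤m) ⟩
    b ^ j * m           ∎
    where
    open ≤-Reasoning
    m = power α
  ... | no  M₀≰m = begin-strict
    S t b (b ^ j * m)   ≡⟨ S-b^* t j m {{power≢0 α}} ⟩
    t ^ j * S t b m     ≤⟨ *-monoʳ-≤ (t ^ j) (≤-maxBelow (S t b) (≰⇒> M₀≰m)) ⟩
    t ^ j * K₀          <⟨ *-monoʳ-< (t ^ j) {{m^n≢0 t j}} (<-trans (exponent-large j m M≤x (≰⇒> M₀≰m)) (n<2^n j)) ⟩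
    t ^ j * 2 ^ j       ≡⟨ sym (^-distribʳ-* t 2 j) ⟩
    (t * 2) ^ j         ≤⟨ ^-monoˡ-≤ j (≤-trans (≤-reflexive (*-comm t 2)) 2t≤b) ⟩
    b ^ j               ≤⟨ m≤m*n (b ^ j) m {{power≢0 α}} ⟩
    b ^ j * m           ∎
    where
    open ≤-Reasoning
    m = power α

  orbit-bounded : ∀ n i → iter (S t b) i n ≤ n ⊔ (S t b n ⊔ maxBelow (S t b) M)
  orbit-bounded = descent⇒iter-bounded (S t b) Generated M S-generated S<-generated

theorem19 : ConjectureB →
    ∀ (b t : ℕ) → Prime b → 5 ≤ b → 4 * t ≤ b →
    ∀ (n : ℕ) → 0 < n →
      ∃[ k ] ∃[ p ] (0 < p × iter (S t b) (k + p) n ≡ iter (S t b) k n)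
theorem19 conjectureB 0 t _ () _ n _
theorem19 conjectureB 1 t _ (s≤s ()) _ n _
theorem19 conjectureB b@(suc (suc k)) zero b-prime _ _ n _ =
  bounded-orbit⇒periodic (S 0 b) n n (decreasing⇒iter-≤ (S 0 b) (Digits.S-zero-≤ k) n)
theorem19 conjectureB b@(suc (suc k)) t@(suc _) b-prime _ 4t≤b n _ =
  bounded-orbit⇒periodic (S t b) n _ (Descent.orbit-bounded conjectureB k b-prime t 2t≤b n)
  where
  2t≤b : 2 * t ≤ b
  2t≤b = ≤-trans (*-monoˡ-≤ t {2} {4} (s≤s (s≤s z≤n))) 4t≤b
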